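{- Let $\mathcal O\subseteq\mathbb C$ be a subring containing $1$. If $P,P'\in\mathrm{PCF}(\mathcal O)$ have types $(N,k)$ and $(N',k)$ with the same period $k$ and the same infinite sequence of partial quotients, then $P\sim P'$.
   Context: A PCF over $\mathcal O$ of type $(N,k)$ ($N\ge0,k\ge1$), $P=[b_1,\dots,b_N,\overline{a_1,\dots,a_k}]$ with $b_i,a_i\in\mathcal O$, is the infinite sequence $b_1,\dots,b_N,a_1,\dots,a_k,a_1,\dots,a_k,\dots$ together with its type; $\mathrm{PCF}(\mathcal O)$ is the set of these. On finite sequences over $\mathcal O$, $\sim$ is the equivalence relation generated by $u[x,0,y]v\sim u[x+y]v$ ($u,v$ sequences, $x,y\in\mathcal O$). Set $\mathsf{SF}(P)=[b_1,\dots,b_N,a_1,\dots,a_k,0,-b_N,\dots,-b_1,0]$ if $N>0$ and $[a_1,\dots,a_k]$ if $N=0$; $P\sim P'$ means $\mathsf{SF}(P)\sim\mathsf{SF}(P')$. -}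

module Defs where

open import Level using (Level)
open import Algebra.Bundles using (CommutativeRing)
open import Data.Nat as ℕ using (ℕ; suc; _∸_; _<?_)
open import Data.Nat.DivMod using (_mod_)
open import Data.Fin using (Fin; fromℕ<)
open import Data.Vec as Vec using (Vec)
open import Data.List using (List; []; _∷_; _++_; reverse; map)
open import Data.List.Relation.Binary.Pointwise using (Pointwise)
open import Relation.Nullary using (yes; no)

module PCFDefs {c ℓ : Level} (R : CommutativeRing c ℓ) where
  open CommutativeRing R

  -- A PCF over R of type (N , k) with k = suc kpred ≥ 1:
  -- preperiod b₁ … b_N and period a₁ … a_k.
  record PCF : Set c where
    constructor pcf
    field
      N     : ℕ
      kpred : ℕ
      pre   : Vec Carrier N
      per   : Vec Carrier (suc kpred)

  open PCF public

  period : PCF → ℕ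
  period P = suc (kpred P)

  -- The infinite sequence of partial quotients (0-indexed):
  -- b₁ … b_N , a₁ … a_k , a₁ … a_k , …
  seq : PCF → ℕ → Carrier
  seq P n with n <? N P
  ... | yes n<N = Vec.lookup (pre P) (fromℕ< n<N)
  ... | no  _   = Vec.lookup (per P) ((n ∸ N P) mod (period P))

  SF : PCF → List Carrier
  SF (pcf ℕ.zero    _ _ a) = Vec.toList a
  SF (pcf (suc N′)  _ b a) =
    Vec.toList b ++ Vec.toList a ++ 0# ∷ reverse (map -_ (Vec.toList b)) ++ 0# ∷ []

  infix 4 _∼_
  data _∼_ : List Carrier → List Carrier → Set (c Level.⊔ ℓ) where
    ∼-≈     : ∀ {s t} → Pointwise _≈_ s t → s ∼ t
    ∼-step  : ∀ u v x y → (u ++ x ∷ 0# ∷ y ∷ v) ∼ (u ++ (x + y) ∷ v)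
    ∼-sym   : ∀ {s t} → s ∼ t → t ∼ s
    ∼-trans : ∀ {s t r} → s ∼ t → t ∼ r → s ∼ r

  infix 4 _∼ᴾ_
  _∼ᴾ_ : PCF → PCF → Set (c Level.⊔ ℓ)
  P ∼ᴾ P′ = SF P ∼ SF P′

{-# OPTIONS --safe #-}

-- Unrolling P, i.e. moving a₁ from the front of the period to the end of the
-- preperiod (preperiod b₁,…,b_N,a₁ and period a₂,…,a_k,a₁), keeps the period
-- and the sequence of partial quotients, and its SF is that of P with a₁
-- replaced by a₁,0,−a₁ (and, when N = 0, with a trailing 0,0 appended), so
-- unrolling preserves ∼.  Unrolling the PCF with the shorter preperiod
-- |N − N′| times makes the two types equal, and a PCF is determined up to ≈
-- by its type and its partial quotients.

module Submission where

open import Defs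
open import Level using (Level)
open import Algebra.Bundles using (CommutativeRing)
open import Data.Nat using (ℕ)
open import Relation.Binary.PropositionalEquality using (_≡_)

open import Data.Nat as ℕ using (zero; suc; _<_; _<?_; _%_; NonZero)
import Data.Nat.Properties as ℕP
open import Data.Nat.DivMod using (_mod_; m≡m%n+[m/n]*n; [m+kn]%n≡m%n; m%n<n; m<n⇒m%n≡m; n%n≡0)
open import Data.Fin as Fin using (toℕ; fromℕ<)
open import Data.Fin.Properties using (fromℕ<-cong; fromℕ<-toℕ; toℕ<n)
open import Data.Vec as Vec using (Vec; lookup)
open import Data.Vec.Properties using (toList-∷ʳ)
open import Data.List using (List; []; _∷_; _++_; _∷ʳ_; reverse; map)
open import Data.List.Properties using (++-assoc; map-++; reverse-++)
open import Data.List.Relation.Binary.Pointwise as Pointwise using (Pointwise)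
open import Data.Product using (_,_)
open import Function.Base using (case_of_)
open import Data.Sum using (inj₁; inj₂)
open import Relation.Binary.Core using (REL)
import Relation.Binary.Reasoning.Base.Single
open import Relation.Binary.Definitions using (tri<; tri≈; tri>)
open import Relation.Nullary using (yes; no)
open import Relation.Nullary.Negation using (contradiction)
open import Relation.Binary.PropositionalEquality as ≡ using (refl; cong; cong₂; sym; trans)

suc[m]%n≡suc[m%n]%n : ∀ m n .{{_ : NonZero n}} → suc m % n ≡ suc (m % n) % n
suc[m]%n≡suc[m%n]%n m n = trans (cong (λ t → suc t % n) (m≡m%n+[m/n]*n m n))
                                ([m+kn]%n≡m%n (suc (m % n)) (m ℕ./ n) n)

module _ {a} {A : Set a} where

  lookup-fromℕ<-cong : ∀ {n i j} (v : Vec A n) → i ≡ j → .(i<n : i < n) .(j<n : j < n) →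
                       lookup v (fromℕ< i<n) ≡ lookup v (fromℕ< j<n)
  lookup-fromℕ<-cong v i≡j i<n j<n = cong (lookup v) (fromℕ<-cong _ _ i≡j i<n j<n)

  lookup-∷ʳ-< : ∀ {n i} (xs : Vec A n) x (i<n : i < n) →
                lookup (xs Vec.∷ʳ x) (fromℕ< (ℕP.m<n⇒m<1+n i<n)) ≡ lookup xs (fromℕ< i<n)
  lookup-∷ʳ-< {i = zero}  (y Vec.∷ ys) x i<n = refl
  lookup-∷ʳ-< {i = suc i} (y Vec.∷ ys) x i<n = lookup-∷ʳ-< ys x (ℕ.s<s⁻¹ i<n)

  lookup-∷ʳ-last : ∀ {n} (xs : Vec A n) x → lookup (xs Vec.∷ʳ x) (fromℕ< (ℕP.n<1+n n)) ≡ x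
  lookup-∷ʳ-last Vec.[]       x = refl
  lookup-∷ʳ-last (y Vec.∷ ys) x = lookup-∷ʳ-last ys x

  lookup-∷ʳ-mod : ∀ {n} (xs : Vec A n) x i →
                  lookup (xs Vec.∷ʳ x) (i mod suc n) ≡ lookup (x Vec.∷ xs) (suc i mod suc n)
  lookup-∷ʳ-mod {n} xs x i with ℕP.m≤n⇒m<n∨m≡n (ℕ.s≤s⁻¹ (m%n<n i (suc n)))
  ... | inj₁ r<n = begin
    lookup (xs Vec.∷ʳ x) (i mod suc n)       ≡⟨ lookup-∷ʳ-< xs x r<n ⟩
    lookup (x Vec.∷ xs) (fromℕ< (ℕ.s≤s r<n))
      ≡⟨ lookup-fromℕ<-cong (x Vec.∷ xs) (sym next≡) (ℕ.s≤s r<n) (m%n<n (suc i) (suc n)) ⟩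
    lookup (x Vec.∷ xs) (suc i mod suc n) ∎
    where
    open ≡.≡-Reasoning
    next≡ : suc i % suc n ≡ suc (i % suc n)
    next≡ = trans (suc[m]%n≡suc[m%n]%n i (suc n)) (m<n⇒m%n≡m (ℕ.s≤s r<n))
  ... | inj₂ r≡n = begin
    lookup (xs Vec.∷ʳ x) (i mod suc n)         ≡⟨ lookup-fromℕ<-cong (xs Vec.∷ʳ x) r≡n _ _ ⟩
    lookup (xs Vec.∷ʳ x) (fromℕ< (ℕP.n<1+n n)) ≡⟨ lookup-∷ʳ-last xs x ⟩
    x
      ≡⟨ lookup-fromℕ<-cong (x Vec.∷ xs) (sym next≡) ℕ.z<s (m%n<n (suc i) (suc n)) ⟩
    lookup (x Vec.∷ xs) (suc i mod suc n) ∎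
    where
    open ≡.≡-Reasoning
    next≡ : suc i % suc n ≡ 0
    next≡ = trans (suc[m]%n≡suc[m%n]%n i (suc n))
                  (trans (cong (λ r → suc r % suc n) r≡n) (n%n≡0 (suc n)))

  Pointwise-toList : ∀ {b ℓ} {B : Set b} {_R_ : REL A B ℓ} {n} (xs : Vec A n) (ys : Vec B n) →
                     (∀ i → lookup xs i R lookup ys i) →
                     Pointwise _R_ (Vec.toList xs) (Vec.toList ys)
  Pointwise-toList Vec.[]       Vec.[]       xs≈ys = Pointwise.[]
  Pointwise-toList (x Vec.∷ xs) (y Vec.∷ ys) xs≈ys =
    xs≈ys Fin.zero Pointwise.∷ Pointwise-toList xs ys (λ i → xs≈ys (Fin.suc i))

  ∷ʳ-++-∷ʳ : ∀ (b : List A) x a r → (b ∷ʳ x) ++ (a ∷ʳ x) ++ r ≡ (b ++ x ∷ a) ++ x ∷ r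
  ∷ʳ-++-∷ʳ b x a r = begin
    (b ∷ʳ x) ++ (a ∷ʳ x) ++ r ≡⟨ ++-assoc b (x ∷ []) _ ⟩
    b ++ x ∷ (a ∷ʳ x) ++ r    ≡⟨ cong (λ t → b ++ x ∷ t) (++-assoc a (x ∷ []) r) ⟩
    b ++ x ∷ a ++ x ∷ r       ≡⟨ ++-assoc b (x ∷ a) (x ∷ r) ⟨
    (b ++ x ∷ a) ++ x ∷ r     ∎
    where open ≡.≡-Reasoning

module PCFEquivalence {c ℓ : Level} (R : CommutativeRing c ℓ) where
  open CommutativeRing R renaming (refl to ≈-refl; sym to ≈-sym; trans to ≈-trans)
  open PCFDefs R

  ∼-refl : ∀ {s} → s ∼ s
  ∼-refl = ∼-≈ (Pointwise.refl ≈-refl)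

  ≈⇒∼-at : ∀ u v {x y} → x ≈ y → u ++ x ∷ v ∼ u ++ y ∷ v
  ≈⇒∼-at u v x≈y =
    ∼-≈ (Pointwise.++⁺ (Pointwise.refl ≈-refl) (x≈y Pointwise.∷ Pointwise.refl ≈-refl))

  module ∼-Reasoning = Relation.Binary.Reasoning.Base.Single _∼_ ∼-refl ∼-trans

  -- The N > 0 formula for SF, applied to a preperiod of any length; for an
  -- empty preperiod it agrees with SF only up to ∼.
  SF⁺ : List Carrier → List Carrier → List Carrier
  SF⁺ b a = b ++ a ++ 0# ∷ reverse (map -_ b) ++ 0# ∷ []

  SF⁺-cong : ∀ {b b′ a a′} → Pointwise _≈_ b b′ → Pointwise _≈_ a a′ →
             Pointwise _≈_ (SF⁺ b a) (SF⁺ b′ a′)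
  SF⁺-cong b≈b′ a≈a′ = Pointwise.++⁺ b≈b′ (Pointwise.++⁺ a≈a′
    (≈-refl Pointwise.∷ Pointwise.++⁺ -b≈-b′ (≈-refl Pointwise.∷ Pointwise.[])))
    where -b≈-b′ = Pointwise.reverse⁺ (Pointwise.map⁺ -_ -_ (Pointwise.map -‿cong b≈b′))

  drop-trailing-0-0 : ∀ s x → (s ∷ʳ x) ++ 0# ∷ 0# ∷ [] ∼ s ∷ʳ x
  drop-trailing-0-0 s x = begin
    (s ∷ʳ x) ++ 0# ∷ 0# ∷ [] ≡⟨ ++-assoc s (x ∷ []) (0# ∷ 0# ∷ []) ⟩
    s ++ x ∷ 0# ∷ 0# ∷ []    ∼⟨ ∼-step s [] x 0# ⟩
    s ++ (x + 0#) ∷ []       ∼⟨ ≈⇒∼-at s [] (+-identityʳ x) ⟩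
    s ∷ʳ x                   ∎
    where open ∼-Reasoning

  SF∼SF⁺ : ∀ P → SF P ∼ SF⁺ (Vec.toList (pre P)) (Vec.toList (per P))
  SF∼SF⁺ (pcf (suc N) kp b a) = ∼-refl
  SF∼SF⁺ (pcf zero    kp Vec.[] a) with Vec.initLast a
  ... | xs , x , refl = begin
    Vec.toList (xs Vec.∷ʳ x)                   ≡⟨ toList-∷ʳ x xs ⟩
    Vec.toList xs ∷ʳ x                         ∼⟨ ∼-sym (drop-trailing-0-0 (Vec.toList xs) x) ⟩
    (Vec.toList xs ∷ʳ x) ++ 0# ∷ 0# ∷ []       ≡⟨ cong (_++ 0# ∷ 0# ∷ []) (toList-∷ʳ x xs) ⟨
    Vec.toList (xs Vec.∷ʳ x) ++ 0# ∷ 0# ∷ []   ∎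
    where open ∼-Reasoning

  SF⁺-∷ʳ : ∀ b x a → SF⁺ (b ∷ʳ x) (a ∷ʳ x) ∼ SF⁺ b (x ∷ a)
  SF⁺-∷ʳ b x a = begin
    SF⁺ (b ∷ʳ x) (a ∷ʳ x)
      ≡⟨ cong (λ t → (b ∷ʳ x) ++ (a ∷ʳ x) ++ 0# ∷ t ++ 0# ∷ []) reverse-negated ⟩
    (b ∷ʳ x) ++ (a ∷ʳ x) ++ 0# ∷ - x ∷ v ≡⟨ ∷ʳ-++-∷ʳ b x a (0# ∷ - x ∷ v) ⟩
    (b ++ x ∷ a) ++ x ∷ 0# ∷ - x ∷ v     ∼⟨ ∼-step (b ++ x ∷ a) v x (- x) ⟩
    (b ++ x ∷ a) ++ (x + - x) ∷ v        ∼⟨ ≈⇒∼-at (b ++ x ∷ a) v (-‿inverseʳ x) ⟩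
    (b ++ x ∷ a) ++ 0# ∷ v               ≡⟨ ++-assoc b (x ∷ a) (0# ∷ v) ⟩
    SF⁺ b (x ∷ a)                        ∎
    where
    open ∼-Reasoning
    v : List Carrier
    v = reverse (map -_ b) ++ 0# ∷ []
    reverse-negated : reverse (map -_ (b ∷ʳ x)) ≡ - x ∷ reverse (map -_ b)
    reverse-negated = trans (cong reverse (map-++ -_ b (x ∷ []))) (reverse-++ (map -_ b) (- x ∷ []))

  infix 4 _≈ˢ_
  _≈ˢ_ : PCF → PCF → Set ℓ
  P ≈ˢ P′ = ∀ n → seq P n ≈ seq P′ n

  ≈ˢ-sym : ∀ P P′ → P ≈ˢ P′ → P′ ≈ˢ P
  ≈ˢ-sym P P′ P≈ˢP′ n = ≈-sym (P≈ˢP′ n)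

  seq-< : ∀ P {n} (n<N : n < N P) → seq P n ≡ lookup (pre P) (fromℕ< n<N)
  seq-< P {n} n<N with n <? N P
  ... | yes _   = refl
  ... | no n≮N = contradiction n<N n≮N

  seq-+ : ∀ P i → seq P (N P ℕ.+ i) ≡ lookup (per P) (i mod period P)
  seq-+ P i with N P ℕ.+ i <? N P
  ... | yes N+i<N = contradiction N+i<N (ℕP.m+n≮m (N P) i)
  ... | no _      = cong (λ t → lookup (per P) (t mod period P)) (ℕP.m+n∸m≡n (N P) i)

  lookup-pre : ∀ P i → lookup (pre P) i ≡ seq P (toℕ i)
  lookup-pre P i = sym (trans (seq-< P (toℕ<n i)) (cong (lookup (pre P)) (fromℕ<-toℕ i _)))

  lookup-per : ∀ P j → lookup (per P) j ≡ seq P (N P ℕ.+ toℕ j)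
  lookup-per P j = sym (trans (seq-+ P (toℕ j))
    (trans (lookup-fromℕ<-cong (per P) (m<n⇒m%n≡m (toℕ<n j)) _ (toℕ<n j))
           (cong (lookup (per P)) (fromℕ<-toℕ j _))))

  sameType⇒∼ᴾ : ∀ P P′ → N P ≡ N P′ → period P ≡ period P′ → P ≈ˢ P′ → P ∼ᴾ P′
  sameType⇒∼ᴾ P@(pcf N kp b a) P′@(pcf _ _ b′ a′) refl refl P≈ˢP′ = begin
    SF P                                ∼⟨ SF∼SF⁺ P ⟩
    SF⁺ (Vec.toList b) (Vec.toList a)   ∼⟨ ∼-≈ (SF⁺-cong b≈b′ a≈a′) ⟩
    SF⁺ (Vec.toList b′) (Vec.toList a′) ∼⟨ ∼-sym (SF∼SF⁺ P′) ⟩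
    SF P′                               ∎
    where
    open ∼-Reasoning
    through-seq : ∀ {u v n} → u ≡ seq P n → v ≡ seq P′ n → u ≈ v
    through-seq u≡ v≡ = ≈-trans (reflexive u≡) (≈-trans (P≈ˢP′ _) (reflexive (sym v≡)))
    b≈b′ : Pointwise _≈_ (Vec.toList b) (Vec.toList b′)
    b≈b′ = Pointwise-toList b b′ (λ i → through-seq (lookup-pre P i) (lookup-pre P′ i))
    a≈a′ : Pointwise _≈_ (Vec.toList a) (Vec.toList a′)
    a≈a′ = Pointwise-toList a a′ (λ j → through-seq (lookup-per P j) (lookup-per P′ j))

  unroll : PCF → PCF
  unroll P = pcf (suc (N P)) (kpred P) (pre P Vec.∷ʳ a₁) (Vec.tail (per P) Vec.∷ʳ a₁)
    where a₁ = Vec.head (per P)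

  seq-unroll : ∀ P n → seq (unroll P) n ≡ seq P n
  seq-unroll P@(pcf N kp b (x Vec.∷ xs)) n with ℕP.<-cmp n N
  ... | tri< n<N _ _ = begin
    seq (unroll P) n                                  ≡⟨ seq-< (unroll P) (ℕP.m<n⇒m<1+n n<N) ⟩
    lookup (b Vec.∷ʳ x) (fromℕ< (ℕP.m<n⇒m<1+n n<N)) ≡⟨ lookup-∷ʳ-< b x n<N ⟩
    lookup b (fromℕ< n<N)                             ≡⟨ seq-< P n<N ⟨
    seq P n                                           ∎
    where open ≡.≡-Reasoning
  ... | tri≈ _ refl _ = begin
    seq (unroll P) N                           ≡⟨ seq-< (unroll P) (ℕP.n<1+n N) ⟩
    lookup (b Vec.∷ʳ x) (fromℕ< (ℕP.n<1+n N)) ≡⟨ lookup-∷ʳ-last b x ⟩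
    x                                          ≡⟨ seq-+ P 0 ⟨
    seq P (N ℕ.+ 0)                            ≡⟨ cong (seq P) (ℕP.+-identityʳ N) ⟩
    seq P N                                    ∎
    where open ≡.≡-Reasoning
  ... | tri> _ _ N<n with ℕP.m≤n⇒∃[o]m+o≡n N<n
  ...   | i , refl = begin
    seq (unroll P) (suc N ℕ.+ i)           ≡⟨ seq-+ (unroll P) i ⟩
    lookup (xs Vec.∷ʳ x) (i mod suc kp)    ≡⟨ lookup-∷ʳ-mod xs x i ⟩
    lookup (x Vec.∷ xs) (suc i mod suc kp) ≡⟨ seq-+ P (suc i) ⟨
    seq P (N ℕ.+ suc i)                    ≡⟨ cong (seq P) (ℕP.+-suc N i) ⟩
    seq P (suc N ℕ.+ i)                    ∎
    where open ≡.≡-Reasoning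

  SF-unroll : ∀ P → unroll P ∼ᴾ P
  SF-unroll P@(pcf N kp b (x Vec.∷ xs)) = begin
    SF (unroll P)                                ≡⟨ cong₂ SF⁺ (toList-∷ʳ x b) (toList-∷ʳ x xs) ⟩
    SF⁺ (Vec.toList b ∷ʳ x) (Vec.toList xs ∷ʳ x) ∼⟨ SF⁺-∷ʳ (Vec.toList b) x (Vec.toList xs) ⟩
    SF⁺ (Vec.toList b) (x ∷ Vec.toList xs)       ∼⟨ ∼-sym (SF∼SF⁺ P) ⟩
    SF P                                         ∎
    where open ∼-Reasoning

  N+m≡N′⇒∼ᴾ : ∀ m P P′ → N P ℕ.+ m ≡ N P′ → period P ≡ period P′ → P ≈ˢ P′ → P ∼ᴾ P′
  N+m≡N′⇒∼ᴾ zero    P P′ N≡N′ k≡k′ P≈ˢP′ =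
    sameType⇒∼ᴾ P P′ (trans (sym (ℕP.+-identityʳ (N P))) N≡N′) k≡k′ P≈ˢP′
  N+m≡N′⇒∼ᴾ (suc m) P P′ N+m≡N′ k≡k′ P≈ˢP′ =
    ∼-trans (∼-sym (SF-unroll P))
      (N+m≡N′⇒∼ᴾ m (unroll P) P′ (trans (sym (ℕP.+-suc (N P) m)) N+m≡N′) k≡k′
        (λ n → ≈-trans (reflexive (seq-unroll P n)) (P≈ˢP′ n)))

proposition4p5 : {c ℓ : Level} (R : CommutativeRing c ℓ) →
    (P P′ : PCFDefs.PCF R) →
    PCFDefs.period R P ≡ PCFDefs.period R P′ →
    ((n : ℕ) → CommutativeRing._≈_ R (PCFDefs.seq R P n) (PCFDefs.seq R P′ n)) →
    PCFDefs._∼ᴾ_ R P P′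
proposition4p5 R P P′ k≡k′ P≈ˢP′ = case ℕP.≤-total (N P) (N P′) of λ where
    (inj₁ N≤N′) → let m , N+m≡N′ = ℕP.m≤n⇒∃[o]m+o≡n N≤N′ in
      N+m≡N′⇒∼ᴾ m P P′ N+m≡N′ k≡k′ P≈ˢP′
    (inj₂ N′≤N) → let m , N′+m≡N = ℕP.m≤n⇒∃[o]m+o≡n N′≤N in
      ∼-sym (N+m≡N′⇒∼ᴾ m P′ P N′+m≡N (sym k≡k′) (≈ˢ-sym P P′ P≈ˢP′))
  where
  open PCFDefs R
  open PCFEquivalence R
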